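{- Every formula provable in Peano arithmetic $\mathbf{PA}$ is also provable in $\mathbf{CLA1}$.
   Context: $\mathbf{PA}$ is taken here as the classical first-order theory whose formulas are the elementary (choice-operator-free) formulas in the language with $=$ (the only predicate), the constant $0$, and function symbols $'$ (successor), $+$, $\times$, and whose axioms are the $\forall$-closures of $0\neq x'$; $x'=y'\to x=y$; $x+0=x$; $x+y'=(x+y)'$; $x\times0=0$; $x\times y'=(x\times y)+x$; and $F(0)\wedge\forall x(F(x)\to F(x'))\to\forall xF(x)$ for every elementary $F(x)$. $\mathbf{CLA1}$: its formulas are built in the same language from atoms and $\top,\bot$ with $\neg$ (on atoms; otherwise an abbreviation, as is $\to$), $\wedge,\vee$, the choice connectives $\sqcap,\sqcup$, and the quantifiers $\forall,\exists$ and choice quantifiers $\sqcap x,\sqcup x$, no formula containing both free and bound occurrences of a variable. Its axioms are the $\mathbf{PA}$ axioms above together with $\sqcap x\sqcup y(y=x')$. It is a natural deduction system: a deduction is a sequence of steps, each a formula or a nested subdeduction with its own hypotheses; premises must be earlier steps of the current or enclosing (sub)deductions or entire earlier subdeductions. Rules (besides axioms as premise-free rules): LC: from $G_1..G_n$ ($n\ge0$) infer $F$ when $\mathbf{CL12}\vdash G_1,\ldots,G_n\mathrel{\bullet\!\!- }F$; CI: from $F(0)$ and a subdeduction with single hypothesis $F(x)$ and last step $F(x')$ infer $\sqcap xF(x)$, $x$ not occurring earlier in the proof. A $\mathbf{CLA1}$-proof of $F$ is a deduction of $F$ from no hypotheses. $\mathbf{CL12}$ is the sequent calculus for sequents $G_1,\ldots,G_n\mathrel{\bullet\!\!-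 }F$ with rules: $\sqcup$-Choose, $\sqcap$-Choose, $\sqcap$x-Choose, $\sqcup$x-Choose (introducing, from the premise with $H_i$ resp. $H(t)$ — $t$ a constant or a variable not bound in the premise — a surface occurrence, i.e. one not in the scope of a choice operator, of $H_0\sqcup H_1$ in the succedent, $H_0\sqcap H_1$ in the antecedent, $\sqcap xH(x)$ in the antecedent, $\sqcup xH(x)$ in the succedent, respectively); Replicate (from $\vec G,E,\vec K,E\mathrel{\bullet\!\!- }F$ infer $\vec G,E,\vec K\mathrel{\bullet\!\!- }F$); and Wait: from $X_1..X_n$ ($n\ge0$) infer $Y$, provided $\|G_1\|\wedge\ldots\wedge\|G_m\|\to\|F\|$ is classically valid for $Y=G_1..G_m\mathrel{\bullet\!\!- }F$ (where $\|\cdot\|$ replaces $\sqcup$- and $\sqcup x$-subformulas by $\bot$ and $\sqcap$- and $\sqcap x$-subformulas by $\top$), and for each surface occurrence of $H_0\sqcap H_1$ or $\sqcap xH(x)$ in the succedent, or $H_0\sqcup H_1$ or $\sqcup xH(x)$ in the antecedent, the sequents with it replaced by $H_0$ and by $H_1$, resp. by $H(y)$ for a variable $y$ not in $Y$, are among the $X_j$. -}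

module Defs where

open import Data.Nat using (ℕ; zero; suc; _≡ᵇ_)
open import Data.Bool using (Bool; true; false; if_then_else_; not; _∧_; _∨_)
open import Data.List using (List; []; _∷_; _++_; map; foldr; last)
open import Data.List.Membership.Propositional using (_∈_; _∉_)
open import Data.List.Relation.Unary.All using (All)
open import Data.Maybe using (Maybe; just)
open import Data.Product using (Σ; _×_)
open import Data.Sum using (_⊎_)
open import Data.Unit using (⊤)
open import Data.Empty using (⊥)
open import Function.Bundles using (_⇔_)
open import Relation.Binary.PropositionalEquality using (_≡_)

data Term : Set where
  var  : ℕ → Term
  zer  : Term
  sc   : Term → Term
  _⊕_  : Term → Term → Term
  _⊗_  : Term → Term → Term

-- Formulas of CLA1 (elementary formulas = those without choice operators).
-- Negation is primitive only on atoms.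
data Formula : Set where
  _≐_  : Term → Term → Formula
  _≠_  : Term → Term → Formula
  ⊤f   : Formula
  ⊥f   : Formula
  _∧f_ : Formula → Formula → Formula
  _∨f_ : Formula → Formula → Formula
  _⊓_  : Formula → Formula → Formula
  _⊔_  : Formula → Formula → Formula
  fall : ℕ → Formula → Formula
  fex  : ℕ → Formula → Formula
  call : ℕ → Formula → Formula
  cex  : ℕ → Formula → Formula

-- ¬ on non-atoms is an abbreviation (De Morgan dualisation), → likewise.
neg : Formula → Formula
neg (t ≐ s) = t ≠ s
neg (t ≠ s) = t ≐ s
neg ⊤f = ⊥f
neg ⊥f = ⊤f
neg (A ∧f B) = neg A ∨f neg B
neg (A ∨f B) = neg A ∧f neg B
neg (A ⊓ B) = neg A ⊔ neg B
neg (A ⊔ B) = neg A ⊓ neg B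
neg (fall x A) = fex x (neg A)
neg (fex x A) = fall x (neg A)
neg (call x A) = cex x (neg A)
neg (cex x A) = call x (neg A)

imp : Formula → Formula → Formula
imp A B = neg A ∨f B

Elem : Formula → Set
Elem (t ≐ s) = ⊤
Elem (t ≠ s) = ⊤
Elem ⊤f = ⊤
Elem ⊥f = ⊤
Elem (A ∧f B) = Elem A × Elem B
Elem (A ∨f B) = Elem A × Elem B
Elem (A ⊓ B) = ⊥
Elem (A ⊔ B) = ⊥
Elem (fall x A) = Elem A
Elem (fex x A) = Elem A
Elem (call x A) = ⊥
Elem (cex x A) = ⊥

removeVar : ℕ → List ℕ → List ℕ
removeVar x [] = []
removeVar x (y ∷ ys) = if x ≡ᵇ y then removeVar x ys else y ∷ removeVar x ys

fvT : Term → List ℕ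
fvT (var x) = x ∷ []
fvT zer = []
fvT (sc t) = fvT t
fvT (t ⊕ s) = fvT t ++ fvT s
fvT (t ⊗ s) = fvT t ++ fvT s

fv : Formula → List ℕ
fv (t ≐ s) = fvT t ++ fvT s
fv (t ≠ s) = fvT t ++ fvT s
fv ⊤f = []
fv ⊥f = []
fv (A ∧f B) = fv A ++ fv B
fv (A ∨f B) = fv A ++ fv B
fv (A ⊓ B) = fv A ++ fv B
fv (A ⊔ B) = fv A ++ fv B
fv (fall x A) = removeVar x (fv A)
fv (fex x A) = removeVar x (fv A)
fv (call x A) = removeVar x (fv A)
fv (cex x A) = removeVar x (fv A)

bv : Formula → List ℕ
bv (t ≐ s) = []
bv (t ≠ s) = []
bv ⊤f = []
bv ⊥f = []
bv (A ∧f B) = bv A ++ bv B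
bv (A ∨f B) = bv A ++ bv B
bv (A ⊓ B) = bv A ++ bv B
bv (A ⊔ B) = bv A ++ bv B
bv (fall x A) = x ∷ bv A
bv (fex x A) = x ∷ bv A
bv (call x A) = x ∷ bv A
bv (cex x A) = x ∷ bv A

vars : Formula → List ℕ
vars A = fv A ++ bv A

-- The standing convention: no formula has both free and bound occurrences
-- of the same variable.
WF : Formula → Set
WF A = (x : ℕ) → x ∈ fv A → x ∈ bv A → ⊥

substT : ℕ → Term → Term → Term
substT x t (var y) = if x ≡ᵇ y then t else var y
substT x t zer = zer
substT x t (sc u) = sc (substT x t u)
substT x t (u ⊕ v) = substT x t u ⊕ substT x t v
substT x t (u ⊗ v) = substT x t u ⊗ substT x t v

subst : ℕ → Term → Formula → Formula
subst x t (u ≐ v) = substT x t u ≐ substT x t v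
subst x t (u ≠ v) = substT x t u ≠ substT x t v
subst x t ⊤f = ⊤f
subst x t ⊥f = ⊥f
subst x t (A ∧f B) = subst x t A ∧f subst x t B
subst x t (A ∨f B) = subst x t A ∨f subst x t B
subst x t (A ⊓ B) = subst x t A ⊓ subst x t B
subst x t (A ⊔ B) = subst x t A ⊔ subst x t B
subst x t (fall y A) = if x ≡ᵇ y then fall y A else fall y (subst x t A)
subst x t (fex y A) = if x ≡ᵇ y then fex y A else fex y (subst x t A)
subst x t (call y A) = if x ≡ᵇ y then call y A else call y (subst x t A)
subst x t (cex y A) = if x ≡ᵇ y then cex y A else cex y (subst x t A)

FreeFor : Term → ℕ → Formula → Set
FreeFor t x (u ≐ v) = ⊤
FreeFor t x (u ≠ v) = ⊤
FreeFor t x ⊤f = ⊤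
FreeFor t x ⊥f = ⊤
FreeFor t x (A ∧f B) = FreeFor t x A × FreeFor t x B
FreeFor t x (A ∨f B) = FreeFor t x A × FreeFor t x B
FreeFor t x (A ⊓ B) = FreeFor t x A × FreeFor t x B
FreeFor t x (A ⊔ B) = FreeFor t x A × FreeFor t x B
FreeFor t x (fall y A) = (x ∉ fv (fall y A)) ⊎ ((y ∉ fvT t) × FreeFor t x A)
FreeFor t x (fex y A) = (x ∉ fv (fex y A)) ⊎ ((y ∉ fvT t) × FreeFor t x A)
FreeFor t x (call y A) = (x ∉ fv (call y A)) ⊎ ((y ∉ fvT t) × FreeFor t x A)
FreeFor t x (cex y A) = (x ∉ fv (cex y A)) ⊎ ((y ∉ fvT t) × FreeFor t x A)

closure : Formula → Formula
closure A = foldr fall A (fv A)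

vx vy : Term
vx = var 0
vy = var 1

data PAAxiom : Formula → Set where
  pa1 : PAAxiom (closure (zer ≠ sc vx))
  pa2 : PAAxiom (closure (imp (sc vx ≐ sc vy) (vx ≐ vy)))
  pa3 : PAAxiom (closure ((vx ⊕ zer) ≐ vx))
  pa4 : PAAxiom (closure ((vx ⊕ sc vy) ≐ sc (vx ⊕ vy)))
  pa5 : PAAxiom (closure ((vx ⊗ zer) ≐ zer))
  pa6 : PAAxiom (closure ((vx ⊗ sc vy) ≐ ((vx ⊗ vy) ⊕ vx)))
  pa-ind : (F : Formula) (x : ℕ) → Elem F →
    PAAxiom (closure (imp (subst x zer F ∧f fall x (imp F (subst x (sc (var x)) F)))
                          (fall x F)))

data CLA1Axiom : Formula → Set where
  ax-pa   : {F : Formula} → PAAxiom F → CLA1Axiom F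
  ax-succ : CLA1Axiom (call 0 (cex 1 (vy ≐ sc vx)))

-- PA: classical first-order logic with identity (Shoenfield's Hilbert
-- calculus; ¬,∨,∃ primitive, ∧,∀ being the De Morgan duals) plus PA axioms.

data PA⊢_ : Formula → Set where
  h-pa     : {A : Formula} → PAAxiom A → PA⊢ A
  h-top    : PA⊢ ⊤f
  h-prop   : {A : Formula} → Elem A → PA⊢ (neg A ∨f A)
  h-subst  : {A : Formula} {x : ℕ} {t : Term} → Elem A → FreeFor t x A →
             PA⊢ imp (subst x t A) (fex x A)
  h-refl   : {x : ℕ} → PA⊢ (var x ≐ var x)
  h-eq-sc  : {x y : ℕ} → PA⊢ imp (var x ≐ var y) (sc (var x) ≐ sc (var y))
  h-eq-⊕   : {x₁ y₁ x₂ y₂ : ℕ} →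
             PA⊢ imp (var x₁ ≐ var y₁) (imp (var x₂ ≐ var y₂)
                   ((var x₁ ⊕ var x₂) ≐ (var y₁ ⊕ var y₂)))
  h-eq-⊗   : {x₁ y₁ x₂ y₂ : ℕ} →
             PA⊢ imp (var x₁ ≐ var y₁) (imp (var x₂ ≐ var y₂)
                   ((var x₁ ⊗ var x₂) ≐ (var y₁ ⊗ var y₂)))
  h-eq-≐   : {x₁ y₁ x₂ y₂ : ℕ} →
             PA⊢ imp (var x₁ ≐ var y₁) (imp (var x₂ ≐ var y₂)
                   (imp (var x₁ ≐ var x₂) (var y₁ ≐ var y₂)))
  h-expand : {A B : Formula} → Elem B → PA⊢ A → PA⊢ (B ∨f A)
  h-contr  : {A : Formula} → PA⊢ (A ∨f A) → PA⊢ A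
  h-assoc  : {A B C : Formula} → PA⊢ (A ∨f (B ∨f C)) → PA⊢ ((A ∨f B) ∨f C)
  h-cut    : {A B C : Formula} → PA⊢ (A ∨f B) → PA⊢ (neg A ∨f C) → PA⊢ (B ∨f C)
  h-∃intro : {A B : Formula} {x : ℕ} → x ∉ fv B → PA⊢ imp A B →
             PA⊢ imp (fex x A) B

-- Classical semantics (for the Wait rule of CL12): models of the
-- elementary language with = interpreted as identity, and a two-valued
-- (classical) truth function obeying Tarski's clauses.

record Structure : Set₁ where
  field
    D    : Set
    zD   : D
    sD   : D → D
    plD  : D → D → D
    tmD  : D → D → D

module _ (S : Structure) where
  open Structure S
  ev : (ℕ → D) → Term → D
  ev ρ (var x) = ρ x
  ev ρ zer = zD
  ev ρ (sc t) = sD (ev ρ t)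
  ev ρ (t ⊕ s) = plD (ev ρ t) (ev ρ s)
  ev ρ (t ⊗ s) = tmD (ev ρ t) (ev ρ s)

upd : {D : Set} → (ℕ → D) → ℕ → D → (ℕ → D)
upd ρ x d y = if x ≡ᵇ y then d else ρ y

record Model : Set₁ where
  field
    str : Structure
  open Structure str public
  field
    sat   : Formula → (ℕ → D) → Bool
    sat-≐ : ∀ t s ρ → (sat (t ≐ s) ρ ≡ true) ⇔ (ev str ρ t ≡ ev str ρ s)
    sat-≠ : ∀ t s ρ → sat (t ≠ s) ρ ≡ not (sat (t ≐ s) ρ)
    sat-⊤ : ∀ ρ → sat ⊤f ρ ≡ true
    sat-⊥ : ∀ ρ → sat ⊥f ρ ≡ false
    sat-∧ : ∀ A B ρ → sat (A ∧f B) ρ ≡ (sat A ρ ∧ sat B ρ)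
    sat-∨ : ∀ A B ρ → sat (A ∨f B) ρ ≡ (sat A ρ ∨ sat B ρ)
    sat-∀ : ∀ x A ρ → (sat (fall x A) ρ ≡ true) ⇔ ((d : D) → sat A (upd ρ x d) ≡ true)
    sat-∃ : ∀ x A ρ → (sat (fex x A) ρ ≡ true) ⇔ Σ D (λ d → sat A (upd ρ x d) ≡ true)

ClassicallyValid : Formula → Set₁
ClassicallyValid E = (M : Model) (ρ : ℕ → Model.D M) → Model.sat M E ρ ≡ true

elz : Formula → Formula
elz (t ≐ s) = t ≐ s
elz (t ≠ s) = t ≠ s
elz ⊤f = ⊤f
elz ⊥f = ⊥f
elz (A ∧f B) = elz A ∧f elz B
elz (A ∨f B) = elz A ∨f elz B
elz (A ⊓ B) = ⊤f
elz (A ⊔ B) = ⊥f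
elz (fall x A) = fall x (elz A)
elz (fex x A) = fex x (elz A)
elz (call x A) = ⊤f
elz (cex x A) = ⊥f

conj : List Formula → Formula
conj = foldr _∧f_ ⊤f

-- Surface occurrences: one-hole contexts not passing through choice operators.

data SCtx : Set where
  hole : SCtx
  ∧L   : SCtx → Formula → SCtx
  ∧R   : Formula → SCtx → SCtx
  ∨L   : SCtx → Formula → SCtx
  ∨R   : Formula → SCtx → SCtx
  allC : ℕ → SCtx → SCtx
  exC  : ℕ → SCtx → SCtx

plug : SCtx → Formula → Formula
plug hole H = H
plug (∧L C B) H = plug C H ∧f B
plug (∧R A C) H = A ∧f plug C H
plug (∨L C B) H = plug C H ∨f B
plug (∨R A C) H = A ∨f plug C H
plug (allC x C) H = fall x (plug C H)
plug (exC x C) H = fex x (plug C H)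

pick : Bool → Formula → Formula → Formula
pick false H₀ H₁ = H₀
pick true  H₀ H₁ = H₁

seqVars : List Formula → Formula → List ℕ
seqVars Gs F = foldr (λ G vs → vars G ++ vs) (vars F) Gs

seqBound : List Formula → Formula → List ℕ
seqBound Gs F = foldr (λ G vs → bv G ++ vs) (bv F) Gs

Instantiable : Term → List Formula → Formula → Set
Instantiable t Gs F = (t ≡ zer) ⊎ Σ ℕ (λ y → (t ≡ var y) × (y ∉ seqBound Gs F))

data CL12 : List Formula → Formula → Set₁ where
  ⊔-choose  : ∀ {Gs} C H₀ H₁ (i : Bool) →
    CL12 Gs (plug C (pick i H₀ H₁)) → CL12 Gs (plug C (H₀ ⊔ H₁))
  ⊓-choose  : ∀ {F} pre post C H₀ H₁ (i : Bool) →
    CL12 (pre ++ plug C (pick i H₀ H₁) ∷ post) F →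
    CL12 (pre ++ plug C (H₀ ⊓ H₁) ∷ post) F
  ⊓x-choose : ∀ {F} pre post C x H (t : Term) →
    Instantiable t (pre ++ plug C (subst x t H) ∷ post) F →
    CL12 (pre ++ plug C (subst x t H) ∷ post) F →
    CL12 (pre ++ plug C (call x H) ∷ post) F
  ⊔x-choose : ∀ {Gs} C x H (t : Term) →
    Instantiable t Gs (plug C (subst x t H)) →
    CL12 Gs (plug C (subst x t H)) →
    CL12 Gs (plug C (cex x H))
  replicate : ∀ {F} pre E post →
    CL12 (pre ++ E ∷ post ++ E ∷ []) F → CL12 (pre ++ E ∷ post) F
  wait : ∀ {Gs F} →
    ClassicallyValid (imp (conj (map elz Gs)) (elz F)) →
    (∀ C H₀ H₁ → F ≡ plug C (H₀ ⊓ H₁) →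
       CL12 Gs (plug C H₀) × CL12 Gs (plug C H₁)) →
    (∀ C x H → F ≡ plug C (call x H) →
       Σ ℕ (λ y → (y ∉ seqVars Gs F) × CL12 Gs (plug C (subst x (var y) H)))) →
    (∀ pre post C H₀ H₁ → Gs ≡ pre ++ plug C (H₀ ⊔ H₁) ∷ post →
       CL12 (pre ++ plug C H₀ ∷ post) F × CL12 (pre ++ plug C H₁ ∷ post) F) →
    (∀ pre post C x H → Gs ≡ pre ++ plug C (cex x H) ∷ post →
       Σ ℕ (λ y → (y ∉ seqVars Gs F) × CL12 (pre ++ plug C (subst x (var y) H) ∷ post) F)) →
    CL12 Gs F

data Step : Set where
  fstep : Formula → Step
  sub   : List Formula → List Step → Step  -- subdeduction: hypotheses, steps

stepsFormulas : List Step → List Formula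
stepsFormulas [] = []
stepsFormulas (fstep F ∷ ss) = F ∷ stepsFormulas ss
stepsFormulas (sub Hs ss′ ∷ ss) = Hs ++ stepsFormulas ss′ ++ stepsFormulas ss

-- Items available as premises: earlier formulas (steps or hypotheses) of the
-- current or enclosing (sub)deductions, and entire earlier subdeductions,
-- the latter recorded together with the list of formulas that occur in the
-- proof before it.
data Item : Set where
  fitem : Formula → Item
  ditem : List Formula → List Step → List Formula → Item

data Justified (av : List Item) : Formula → Set₁ where
  j-axiom : ∀ {F} → CLA1Axiom F → Justified av F
  j-LC    : ∀ {F} (Gs : List Formula) → All (λ G → fitem G ∈ av) Gs →
            CL12 Gs F → Justified av F
  j-CI    : ∀ {x A ss prior} →
            fitem (subst x zer A) ∈ av →
            ditem (A ∷ []) ss prior ∈ av →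
            last ss ≡ just (fstep (subst x (sc (var x)) A)) →
            (∀ G → G ∈ prior → x ∉ vars G) →
            Justified av (call x A)

-- Deduces av prior ss : the step sequence ss is correct, given available
-- premises av and the formulas `prior` occurring earlier in the proof.
data Deduces : List Item → List Formula → List Step → Set₁ where
  d-nil  : ∀ {av prior} → Deduces av prior []
  d-form : ∀ {av prior F ss} → WF F → Justified av F →
           Deduces (fitem F ∷ av) (F ∷ prior) ss →
           Deduces av prior (fstep F ∷ ss)
  d-sub  : ∀ {av prior Hs ss′ ss} → All WF Hs →
           Deduces (map fitem Hs ++ av) (Hs ++ prior) ss′ →
           Deduces (ditem Hs ss′ prior ∷ av) (stepsFormulas ss′ ++ Hs ++ prior) ss →
           Deduces av prior (sub Hs ss′ ∷ ss)

CLA1⊢_ : Formula → Set₁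
CLA1⊢ F = Σ (List Step) (λ ss → Deduces [] [] ss × (last ss ≡ just (fstep F)))

-- A PA-proof of F uses finitely many axioms G₁ … Gₙ, all elementary and
-- closed, and by soundness G₁ ∧ … ∧ Gₙ → F is classically valid.  Since the
-- sequent G₁ … Gₙ •− F contains no choice operators, Wait derives it in CL12
-- from no premises, so the CLA1 deduction "G₁, …, Gₙ (axioms), F (by LC)"
-- proves F.

module Submission where

open import Defs
open import Data.Bool using (Bool; true; false; not; _∧_; _∨_; if_then_else_)
open import Data.Bool.Properties using (⇔→≡; not-involutive)
open import Data.Empty using (⊥; ⊥-elim)
open import Data.List using (List; []; _∷_; _++_; _∷ʳ_; map; foldr; last)
open import Data.List.Membership.Propositional using (_∈_; _∉_)
open import Data.List.Membership.Propositional.Properties using (∈-++⁺ˡ; ∈-++⁺ʳ)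
open import Data.List.Properties using (++-assoc; ++-identityʳ; map-id-local)
open import Data.List.Relation.Unary.All using (All; []; _∷_)
import Data.List.Relation.Unary.All as All
open import Data.List.Relation.Unary.All.Properties using (++⁺; ++⁻ˡ; ++⁻ʳ)
open import Data.List.Relation.Unary.Any using (here; there)
open import Data.Maybe using (just)
open import Data.Nat using (ℕ; _≡ᵇ_)
open import Data.Nat.Properties using (_≟_)
open import Data.Product using (∃; _×_; _,_; proj₁; proj₂)
open import Data.Sum using (_⊎_; inj₁; inj₂; [_,_])
open import Data.Unit using (tt)
open import Function using (id; const; _∘_)
open import Function.Bundles using (_⇔_; mk⇔; Equivalence)
open import Relation.Nullary using (contradiction; proof; Reflects; ofʸ; ofⁿ)
open import Relation.Binary.PropositionalEquality
  using (_≡_; _≢_; refl; sym; trans; cong; cong₂; module ≡-Reasoning)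
  renaming (subst to transport)

open Equivalence

≡ᵇ-reflects : ∀ m n → Reflects (m ≡ n) (m ≡ᵇ n)
≡ᵇ-reflects m n = proof (m ≟ n)

∈-removeVar⁺ : ∀ {x y} l → y ∈ l → x ≢ y → y ∈ removeVar x l
∈-removeVar⁺ {x} (z ∷ zs) y∈ x≢y with x ≡ᵇ z | ≡ᵇ-reflects x z | y∈
... | true  | ofʸ refl | here refl  = ⊥-elim (x≢y refl)
... | true  | ofʸ refl | there y∈zs = ∈-removeVar⁺ zs y∈zs x≢y
... | false | ofⁿ _    | here refl  = here refl
... | false | ofⁿ _    | there y∈zs = there (∈-removeVar⁺ zs y∈zs x≢y)

∈-removeVar⁻ : ∀ {x y} l → y ∈ removeVar x l → y ∈ l × x ≢ y
∈-removeVar⁻ {x} (z ∷ zs) y∈ with x ≡ᵇ z | ≡ᵇ-reflects x z | y∈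
... | true  | _       | y∈′        = let y∈zs , x≢y = ∈-removeVar⁻ zs y∈′ in there y∈zs , x≢y
... | false | ofⁿ x≢z | here refl  = here refl , x≢z
... | false | ofⁿ _   | there y∈′  = let y∈zs , x≢y = ∈-removeVar⁻ zs y∈′ in there y∈zs , x≢y

∉-removeVar : ∀ x l → x ∉ removeVar x l
∉-removeVar x l x∈ = proj₂ (∈-removeVar⁻ l x∈) refl

Closed : Formula → Set
Closed A = ∀ y → y ∉ fv A

∈-fv-foldr-fall : ∀ A xs {y} → y ∈ fv (foldr fall A xs) → y ∈ fv A × y ∉ xs
∈-fv-foldr-fall A []       y∈ = y∈ , λ ()
∈-fv-foldr-fall A (x ∷ xs) y∈ with ∈-removeVar⁻ (fv (foldr fall A xs)) y∈
... | y∈′ , x≢y with ∈-fv-foldr-fall A xs y∈′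
...   | y∈A , y∉xs = y∈A , λ { (here refl) → x≢y refl ; (there y∈xs) → y∉xs y∈xs }

closure-closed : ∀ A → Closed (closure A)
closure-closed A y y∈ = let y∈A , y∉fvA = ∈-fv-foldr-fall A (fv A) y∈ in y∉fvA y∈A

induction-premise : Formula → ℕ → Formula
induction-premise F x = subst x zer F ∧f fall x (imp F (subst x (sc (var x)) F))

induction-instance : Formula → ℕ → Formula
induction-instance F x = imp (induction-premise F x) (fall x F)

PAAxiom-closed : ∀ {A} → PAAxiom A → Closed A
PAAxiom-closed pa1            = closure-closed (zer ≠ sc vx)
PAAxiom-closed pa2            = closure-closed (imp (sc vx ≐ sc vy) (vx ≐ vy))
PAAxiom-closed pa3            = closure-closed ((vx ⊕ zer) ≐ vx)
PAAxiom-closed pa4            = closure-closed ((vx ⊕ sc vy) ≐ sc (vx ⊕ vy))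
PAAxiom-closed pa5            = closure-closed ((vx ⊗ zer) ≐ zer)
PAAxiom-closed pa6            = closure-closed ((vx ⊗ sc vy) ≐ ((vx ⊗ vy) ⊕ vx))
PAAxiom-closed (pa-ind F x _) = closure-closed (induction-instance F x)

PAAxiom-WF : ∀ {A} → PAAxiom A → WF A
PAAxiom-WF ax x x∈fv _ = PAAxiom-closed ax x x∈fv

Elem-neg : ∀ A → Elem A → Elem (neg A)
Elem-neg (t ≐ s)    _       = tt
Elem-neg (t ≠ s)    _       = tt
Elem-neg ⊤f         _       = tt
Elem-neg ⊥f         _       = tt
Elem-neg (A ∧f B)   (a , b) = Elem-neg A a , Elem-neg B b
Elem-neg (A ∨f B)   (a , b) = Elem-neg A a , Elem-neg B b
Elem-neg (fall x A) a       = Elem-neg A a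
Elem-neg (fex x A)  a       = Elem-neg A a

Elem-subst : ∀ A x t → Elem A → Elem (subst x t A)
Elem-subst (u ≐ v)    x t _       = tt
Elem-subst (u ≠ v)    x t _       = tt
Elem-subst ⊤f         x t _       = tt
Elem-subst ⊥f         x t _       = tt
Elem-subst (A ∧f B)   x t (a , b) = Elem-subst A x t a , Elem-subst B x t b
Elem-subst (A ∨f B)   x t (a , b) = Elem-subst A x t a , Elem-subst B x t b
Elem-subst (fall y A) x t a with x ≡ᵇ y
... | true  = a
... | false = Elem-subst A x t a
Elem-subst (fex y A)  x t a with x ≡ᵇ y
... | true  = a
... | false = Elem-subst A x t a

Elem-foldr-fall : ∀ {A} xs → Elem A → Elem (foldr fall A xs)
Elem-foldr-fall []       a = a
Elem-foldr-fall (_ ∷ xs) a = Elem-foldr-fall xs a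

PAAxiom-Elem : ∀ {A} → PAAxiom A → Elem A
PAAxiom-Elem pa1 = tt
PAAxiom-Elem pa2 = tt , tt
PAAxiom-Elem pa3 = tt
PAAxiom-Elem pa4 = tt
PAAxiom-Elem pa5 = tt
PAAxiom-Elem pa6 = tt
PAAxiom-Elem (pa-ind F x f) = Elem-foldr-fall (fv (induction-instance F x)) (premise , f)
  where
  premise : Elem (neg (induction-premise F x))
  premise = Elem-neg (induction-premise F x)
    (Elem-subst F x zer f , Elem-neg F f , Elem-subst F x (sc (var x)) f)

PA⊢-Elem : ∀ {F} → PA⊢ F → Elem F
PA⊢-Elem (h-pa ax)                   = PAAxiom-Elem ax
PA⊢-Elem h-top                       = tt
PA⊢-Elem (h-prop {A} a)              = Elem-neg A a , a
PA⊢-Elem (h-subst {A} {x} {t} a _)   = Elem-neg (subst x t A) (Elem-subst A x t a) , a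
PA⊢-Elem h-refl                      = tt
PA⊢-Elem h-eq-sc                     = tt , tt
PA⊢-Elem h-eq-⊕                      = tt , tt , tt
PA⊢-Elem h-eq-⊗                      = tt , tt , tt
PA⊢-Elem h-eq-≐                      = tt , tt , tt , tt
PA⊢-Elem (h-expand b d)              = b , PA⊢-Elem d
PA⊢-Elem (h-contr d)                 = proj₁ (PA⊢-Elem d)
PA⊢-Elem (h-assoc d)                 = let a , b , c = PA⊢-Elem d in (a , b) , c
PA⊢-Elem (h-cut d₁ d₂)               = proj₂ (PA⊢-Elem d₁) , proj₂ (PA⊢-Elem d₂)
PA⊢-Elem (h-∃intro _ d)              = PA⊢-Elem d

elz-Elem : ∀ A → Elem A → elz A ≡ A
elz-Elem (t ≐ s)    _       = refl
elz-Elem (t ≠ s)    _       = refl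
elz-Elem ⊤f         _       = refl
elz-Elem ⊥f         _       = refl
elz-Elem (A ∧f B)   (a , b) = cong₂ _∧f_ (elz-Elem A a) (elz-Elem B b)
elz-Elem (A ∨f B)   (a , b) = cong₂ _∨f_ (elz-Elem A a) (elz-Elem B b)
elz-Elem (fall x A) a       = cong (fall x) (elz-Elem A a)
elz-Elem (fex x A)  a       = cong (fex x) (elz-Elem A a)

Elem-conj : ∀ {Gs} → All Elem Gs → Elem (conj Gs)
Elem-conj []       = tt
Elem-conj (g ∷ gs) = g , Elem-conj gs

Elem-plug : ∀ C {H} → Elem (plug C H) → Elem H
Elem-plug hole       h       = h
Elem-plug (∧L C _)   (h , _) = Elem-plug C h
Elem-plug (∧R _ C)   (_ , h) = Elem-plug C h
Elem-plug (∨L C _)   (h , _) = Elem-plug C h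
Elem-plug (∨R _ C)   (_ , h) = Elem-plug C h
Elem-plug (allC _ C) h       = Elem-plug C h
Elem-plug (exC _ C)  h       = Elem-plug C h

substT-fresh : ∀ x t u → x ∉ fvT u → substT x t u ≡ u
substT-fresh x t (var y) x∉ with x ≡ᵇ y | ≡ᵇ-reflects x y
... | true  | ofʸ refl = ⊥-elim (x∉ (here refl))
... | false | _        = refl
substT-fresh x t zer     x∉ = refl
substT-fresh x t (sc u)  x∉ = cong sc (substT-fresh x t u x∉)
substT-fresh x t (u ⊕ v) x∉ =
  cong₂ _⊕_ (substT-fresh x t u (x∉ ∘ ∈-++⁺ˡ)) (substT-fresh x t v (x∉ ∘ ∈-++⁺ʳ (fvT u)))
substT-fresh x t (u ⊗ v) x∉ =
  cong₂ _⊗_ (substT-fresh x t u (x∉ ∘ ∈-++⁺ˡ)) (substT-fresh x t v (x∉ ∘ ∈-++⁺ʳ (fvT u)))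

if-≡ᵇ-fresh : ∀ {x y} (Q : Formula → Formula) {A A′} → (x ≢ y → A′ ≡ A) →
              (if x ≡ᵇ y then Q A else Q A′) ≡ Q A
if-≡ᵇ-fresh {x} {y} Q A′≡A with x ≡ᵇ y | ≡ᵇ-reflects x y
... | true  | _       = refl
... | false | ofⁿ x≢y = cong Q (A′≡A x≢y)

subst-fresh : ∀ A x t → x ∉ fv A → subst x t A ≡ A
subst-fresh-body : ∀ {y} A x t → x ∉ removeVar y (fv A) → x ≢ y → subst x t A ≡ A

subst-fresh (u ≐ v)    x t x∉ =
  cong₂ _≐_ (substT-fresh x t u (x∉ ∘ ∈-++⁺ˡ)) (substT-fresh x t v (x∉ ∘ ∈-++⁺ʳ (fvT u)))
subst-fresh (u ≠ v)    x t x∉ =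
  cong₂ _≠_ (substT-fresh x t u (x∉ ∘ ∈-++⁺ˡ)) (substT-fresh x t v (x∉ ∘ ∈-++⁺ʳ (fvT u)))
subst-fresh ⊤f         x t x∉ = refl
subst-fresh ⊥f         x t x∉ = refl
subst-fresh (A ∧f B)   x t x∉ =
  cong₂ _∧f_ (subst-fresh A x t (x∉ ∘ ∈-++⁺ˡ)) (subst-fresh B x t (x∉ ∘ ∈-++⁺ʳ (fv A)))
subst-fresh (A ∨f B)   x t x∉ =
  cong₂ _∨f_ (subst-fresh A x t (x∉ ∘ ∈-++⁺ˡ)) (subst-fresh B x t (x∉ ∘ ∈-++⁺ʳ (fv A)))
subst-fresh (A ⊓ B)    x t x∉ =
  cong₂ _⊓_ (subst-fresh A x t (x∉ ∘ ∈-++⁺ˡ)) (subst-fresh B x t (x∉ ∘ ∈-++⁺ʳ (fv A)))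
subst-fresh (A ⊔ B)    x t x∉ =
  cong₂ _⊔_ (subst-fresh A x t (x∉ ∘ ∈-++⁺ˡ)) (subst-fresh B x t (x∉ ∘ ∈-++⁺ʳ (fv A)))
subst-fresh (fall y A) x t x∉ = if-≡ᵇ-fresh (fall y) (subst-fresh-body A x t x∉)
subst-fresh (fex y A)  x t x∉ = if-≡ᵇ-fresh (fex y)  (subst-fresh-body A x t x∉)
subst-fresh (call y A) x t x∉ = if-≡ᵇ-fresh (call y) (subst-fresh-body A x t x∉)
subst-fresh (cex y A)  x t x∉ = if-≡ᵇ-fresh (cex y)  (subst-fresh-body A x t x∉)

subst-fresh-body A x t x∉ x≢y = subst-fresh A x t (λ x∈ → x∉ (∈-removeVar⁺ (fv A) x∈ (x≢y ∘ sym)))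

Agree : {D : Set} → (ℕ → D) → (ℕ → D) → List ℕ → Set
Agree ρ σ l = ∀ {y} → y ∈ l → ρ y ≡ σ y

Agree-upd : ∀ {D : Set} {ρ σ : ℕ → D} x v l → Agree ρ σ (removeVar x l) →
            Agree (upd ρ x v) (upd σ x v) l
Agree-upd x v l ag {y} y∈ with x ≡ᵇ y | ≡ᵇ-reflects x y
... | true  | _       = refl
... | false | ofⁿ x≢y = ag (∈-removeVar⁺ l y∈ x≢y)

Agree-upd-fresh : ∀ {D : Set} (ρ : ℕ → D) {x} v {l} → x ∉ l → Agree ρ (upd ρ x v) l
Agree-upd-fresh ρ {x} v x∉ {y} y∈ with x ≡ᵇ y | ≡ᵇ-reflects x y
... | true  | ofʸ refl = ⊥-elim (x∉ y∈)
... | false | _        = refl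

upd-comm : ∀ {D : Set} (ρ : ℕ → D) {x y} u v → x ≢ y →
           ∀ z → upd (upd ρ y v) x u z ≡ upd (upd ρ x u) y v z
upd-comm ρ {x} {y} u v x≢y z with x ≡ᵇ z | ≡ᵇ-reflects x z | y ≡ᵇ z | ≡ᵇ-reflects y z
... | true  | ofʸ refl | true  | ofʸ refl = ⊥-elim (x≢y refl)
... | true  | _        | false | _        = refl
... | false | _        | _     | _        = refl

module _ (S : Structure) where
  open Structure S

  ev-agree : ∀ t {ρ σ} → Agree ρ σ (fvT t) → ev S ρ t ≡ ev S σ t
  ev-agree (var x) ag = ag (here refl)
  ev-agree zer     ag = refl
  ev-agree (sc t)  ag = cong sD (ev-agree t ag)
  ev-agree (t ⊕ s) ag = cong₂ plD (ev-agree t (ag ∘ ∈-++⁺ˡ)) (ev-agree s (ag ∘ ∈-++⁺ʳ (fvT t)))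
  ev-agree (t ⊗ s) ag = cong₂ tmD (ev-agree t (ag ∘ ∈-++⁺ˡ)) (ev-agree s (ag ∘ ∈-++⁺ʳ (fvT t)))

  ev-substT : ∀ x t u ρ → ev S ρ (substT x t u) ≡ ev S (upd ρ x (ev S ρ t)) u
  ev-substT x t (var y) ρ with x ≡ᵇ y
  ... | true  = refl
  ... | false = refl
  ev-substT x t zer     ρ = refl
  ev-substT x t (sc u)  ρ = cong sD (ev-substT x t u ρ)
  ev-substT x t (u ⊕ v) ρ = cong₂ plD (ev-substT x t u ρ) (ev-substT x t v ρ)
  ev-substT x t (u ⊗ v) ρ = cong₂ tmD (ev-substT x t u ρ) (ev-substT x t v ρ)

∨-≡-true : ∀ {a b} → (a ∨ b ≡ true) ⇔ (a ≡ true ⊎ b ≡ true)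
∨-≡-true {true}  = mk⇔ inj₁ (const refl)
∨-≡-true {false} = mk⇔ inj₂ [ (λ ()) , id ]

∧-≡-true : ∀ {a b} → (a ∧ b ≡ true) ⇔ (a ≡ true × b ≡ true)
∧-≡-true {true}  = mk⇔ (refl ,_) proj₂
∧-≡-true {false} = mk⇔ (λ ()) (λ { (() , _) })

not-∧ : ∀ a b → not (a ∧ b) ≡ not a ∨ not b
not-∧ true  b = refl
not-∧ false b = refl

not-∨ : ∀ a b → not (a ∨ b) ≡ not a ∧ not b
not-∨ true  b = refl
not-∨ false b = refl

≡-not-sym : ∀ {a b} → a ≡ not b → b ≡ not a
≡-not-sym {b = b} a≡¬b = trans (sym (not-involutive b)) (cong not (sym a≡¬b))

-- The Boolean form of ¬∀ ↔ ∃¬; the last case is where classical logic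
-- enters, through the decidability of f d.
quantifier-duality : ∀ {D : Set} {a b : Bool} {f g : D → Bool} →
                     (a ≡ true ⇔ (∀ d → f d ≡ true)) → (b ≡ true ⇔ ∃ λ d → g d ≡ true) →
                     (∀ d → g d ≡ not (f d)) → b ≡ not a
quantifier-duality {a = true}  {false} _  _  _  = refl
quantifier-duality {a = false} {true}  _  _  _  = refl
quantifier-duality {a = true}  {true}  a⇔ b⇔ g≡ =
  let d , gd = b⇔ .to refl in
  contradiction (trans (sym gd) (trans (g≡ d) (cong not (a⇔ .to refl d)))) λ ()
quantifier-duality {a = false} {false} {f} a⇔ b⇔ g≡ = contradiction (a⇔ .from all-f) λ ()
  where
  all-f : ∀ d → f d ≡ true
  all-f d with f d in fd
  ... | true  = refl
  ... | false = contradiction (b⇔ .from (d , trans (g≡ d) (cong not fd))) λ ()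

module _ (M : Model) where
  open Model M

  Valid : Formula → Set
  Valid A = ∀ ρ → sat A ρ ≡ true

  ∨-holds : ∀ {A B ρ} → sat (A ∨f B) ρ ≡ true ⇔ (sat A ρ ≡ true ⊎ sat B ρ ≡ true)
  ∨-holds {A} {B} {ρ} rewrite sat-∨ A B ρ = ∨-≡-true

  ∧-holds : ∀ {A B ρ} → sat (A ∧f B) ρ ≡ true ⇔ (sat A ρ ≡ true × sat B ρ ≡ true)
  ∧-holds {A} {B} {ρ} rewrite sat-∧ A B ρ = ∧-≡-true

  ≐-cong : ∀ {t s t′ s′ ρ σ} → ev str ρ t ≡ ev str σ t′ → ev str ρ s ≡ ev str σ s′ →
           sat (t ≐ s) ρ ≡ sat (t′ ≐ s′) σ
  ≐-cong {t} {s} {t′} {s′} {ρ} {σ} t≡ s≡ = ⇔→≡ (mk⇔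
    (λ h → sat-≐ t′ s′ σ .from (trans (sym t≡) (trans (sat-≐ t s ρ .to h) s≡)))
    (λ h → sat-≐ t s ρ .from (trans t≡ (trans (sat-≐ t′ s′ σ .to h) (sym s≡)))))

  ≠-cong : ∀ {t s t′ s′ ρ σ} → ev str ρ t ≡ ev str σ t′ → ev str ρ s ≡ ev str σ s′ →
           sat (t ≠ s) ρ ≡ sat (t′ ≠ s′) σ
  ≠-cong {t} {s} {t′} {s′} {ρ} {σ} t≡ s≡ =
    trans (sat-≠ t s ρ) (trans (cong not (≐-cong t≡ s≡)) (sym (sat-≠ t′ s′ σ)))

  ∧-cong : ∀ {A B A′ B′ ρ σ} → sat A ρ ≡ sat A′ σ → sat B ρ ≡ sat B′ σ →
           sat (A ∧f B) ρ ≡ sat (A′ ∧f B′) σ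
  ∧-cong {A} {B} {A′} {B′} {ρ} {σ} A≡ B≡ =
    trans (sat-∧ A B ρ) (trans (cong₂ _∧_ A≡ B≡) (sym (sat-∧ A′ B′ σ)))

  ∨-cong : ∀ {A B A′ B′ ρ σ} → sat A ρ ≡ sat A′ σ → sat B ρ ≡ sat B′ σ →
           sat (A ∨f B) ρ ≡ sat (A′ ∨f B′) σ
  ∨-cong {A} {B} {A′} {B′} {ρ} {σ} A≡ B≡ =
    trans (sat-∨ A B ρ) (trans (cong₂ _∨_ A≡ B≡) (sym (sat-∨ A′ B′ σ)))

  ∀-cong : ∀ {x A A′ ρ σ} → (∀ v → sat A (upd ρ x v) ≡ sat A′ (upd σ x v)) →
           sat (fall x A) ρ ≡ sat (fall x A′) σ
  ∀-cong {x} {A} {A′} {ρ} {σ} A≡ = ⇔→≡ (mk⇔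
    (λ h → sat-∀ x A′ σ .from λ v → trans (sym (A≡ v)) (sat-∀ x A ρ .to h v))
    (λ h → sat-∀ x A ρ .from λ v → trans (A≡ v) (sat-∀ x A′ σ .to h v)))

  ∃-cong : ∀ {x A A′ ρ σ} → (∀ v → sat A (upd ρ x v) ≡ sat A′ (upd σ x v)) →
           sat (fex x A) ρ ≡ sat (fex x A′) σ
  ∃-cong {x} {A} {A′} {ρ} {σ} A≡ = ⇔→≡ (mk⇔
    (λ h → let v , p = sat-∃ x A ρ .to h in sat-∃ x A′ σ .from (v , trans (sym (A≡ v)) p))
    (λ h → let v , p = sat-∃ x A′ σ .to h in sat-∃ x A ρ .from (v , trans (A≡ v) p)))

  coincidence : ∀ A → Elem A → ∀ {ρ σ} → Agree ρ σ (fv A) → sat A ρ ≡ sat A σ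
  coincidence (t ≐ s)    _ ag =
    ≐-cong (ev-agree str t (ag ∘ ∈-++⁺ˡ)) (ev-agree str s (ag ∘ ∈-++⁺ʳ (fvT t)))
  coincidence (t ≠ s)    _ ag =
    ≠-cong (ev-agree str t (ag ∘ ∈-++⁺ˡ)) (ev-agree str s (ag ∘ ∈-++⁺ʳ (fvT t)))
  coincidence ⊤f         _ {ρ} {σ} _ = trans (sat-⊤ ρ) (sym (sat-⊤ σ))
  coincidence ⊥f         _ {ρ} {σ} _ = trans (sat-⊥ ρ) (sym (sat-⊥ σ))
  coincidence (A ∧f B)   (a , b) ag =
    ∧-cong (coincidence A a (ag ∘ ∈-++⁺ˡ)) (coincidence B b (ag ∘ ∈-++⁺ʳ (fv A)))
  coincidence (A ∨f B)   (a , b) ag =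
    ∨-cong (coincidence A a (ag ∘ ∈-++⁺ˡ)) (coincidence B b (ag ∘ ∈-++⁺ʳ (fv A)))
  coincidence (fall x A) a ag = ∀-cong λ v → coincidence A a (Agree-upd x v (fv A) ag)
  coincidence (fex x A)  a ag = ∃-cong λ v → coincidence A a (Agree-upd x v (fv A) ag)

  sat-upd-fresh : ∀ A {x ρ v} → Elem A → x ∉ fv A → sat A (upd ρ x v) ≡ sat A ρ
  sat-upd-fresh A {ρ = ρ} {v} a x∉ = sym (coincidence A a (Agree-upd-fresh ρ v x∉))

  sat-subst-fresh : ∀ A {x t ρ v} → Elem A → x ∉ fv A → sat (subst x t A) ρ ≡ sat A (upd ρ x v)
  sat-subst-fresh A {x} {t} {ρ} a x∉ =
    trans (cong (λ B → sat B ρ) (subst-fresh A x t x∉)) (sym (sat-upd-fresh A a x∉))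

  sat-subst-under-binder :
    ∀ A {x y t} → Elem A → x ≢ y → y ∉ fvT t →
    (∀ ρ → sat (subst x t A) ρ ≡ sat A (upd ρ x (ev str ρ t))) →
    ∀ {ρ} v → sat (subst x t A) (upd ρ y v) ≡ sat A (upd (upd ρ x (ev str ρ t)) y v)
  sat-subst-under-binder A {x} {y} {t} a x≢y y∉t sat-subst-A {ρ} v = begin
    sat (subst x t A) (upd ρ y v)                     ≡⟨ sat-subst-A (upd ρ y v) ⟩
    sat A (upd (upd ρ y v) x (ev str (upd ρ y v) t))  ≡⟨ cong (λ u → sat A (upd (upd ρ y v) x u)) t-unchanged ⟩
    sat A (upd (upd ρ y v) x (ev str ρ t))            ≡⟨ coincidence A a (λ {z} _ → upd-comm ρ _ v x≢y z) ⟩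
    sat A (upd (upd ρ x (ev str ρ t)) y v)            ∎
    where
    open ≡-Reasoning
    t-unchanged : ev str (upd ρ y v) t ≡ ev str ρ t
    t-unchanged = ev-agree str t λ z∈ → sym (Agree-upd-fresh ρ v y∉t z∈)

  sat-subst : ∀ A x t → Elem A → FreeFor t x A →
              ∀ ρ → sat (subst x t A) ρ ≡ sat A (upd ρ x (ev str ρ t))
  sat-subst (u ≐ v)    x t _ _ ρ = ≐-cong (ev-substT str x t u ρ) (ev-substT str x t v ρ)
  sat-subst (u ≠ v)    x t _ _ ρ = ≠-cong (ev-substT str x t u ρ) (ev-substT str x t v ρ)
  sat-subst ⊤f         x t _ _ ρ = trans (sat-⊤ ρ) (sym (sat-⊤ _))
  sat-subst ⊥f         x t _ _ ρ = trans (sat-⊥ ρ) (sym (sat-⊥ _))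
  sat-subst (A ∧f B)   x t (a , b) (fa , fb) ρ = ∧-cong (sat-subst A x t a fa ρ) (sat-subst B x t b fb ρ)
  sat-subst (A ∨f B)   x t (a , b) (fa , fb) ρ = ∨-cong (sat-subst A x t a fa ρ) (sat-subst B x t b fb ρ)
  sat-subst (fall y A) x t a (inj₁ x∉) ρ = sat-subst-fresh (fall y A) a x∉
  sat-subst (fall y A) x t a (inj₂ (y∉t , fa)) ρ with x ≡ᵇ y | ≡ᵇ-reflects x y
  ... | true  | ofʸ refl = sym (sat-upd-fresh (fall x A) a (∉-removeVar x (fv A)))
  ... | false | ofⁿ x≢y = ∀-cong (sat-subst-under-binder A a x≢y y∉t (sat-subst A x t a fa))
  sat-subst (fex y A)  x t a (inj₁ x∉) ρ = sat-subst-fresh (fex y A) a x∉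
  sat-subst (fex y A)  x t a (inj₂ (y∉t , fa)) ρ with x ≡ᵇ y | ≡ᵇ-reflects x y
  ... | true  | ofʸ refl = sym (sat-upd-fresh (fex x A) a (∉-removeVar x (fv A)))
  ... | false | ofⁿ x≢y = ∃-cong (sat-subst-under-binder A a x≢y y∉t (sat-subst A x t a fa))

  sat-neg : ∀ A → Elem A → ∀ ρ → sat (neg A) ρ ≡ not (sat A ρ)
  sat-neg (t ≐ s)    _ ρ = sat-≠ t s ρ
  sat-neg (t ≠ s)    _ ρ = ≡-not-sym (sat-≠ t s ρ)
  sat-neg ⊤f         _ ρ = trans (sat-⊥ ρ) (cong not (sym (sat-⊤ ρ)))
  sat-neg ⊥f         _ ρ = trans (sat-⊤ ρ) (cong not (sym (sat-⊥ ρ)))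
  sat-neg (A ∧f B)   (a , b) ρ =
    trans (sat-∨ (neg A) (neg B) ρ) (trans (cong₂ _∨_ (sat-neg A a ρ) (sat-neg B b ρ))
      (trans (sym (not-∧ (sat A ρ) (sat B ρ))) (cong not (sym (sat-∧ A B ρ)))))
  sat-neg (A ∨f B)   (a , b) ρ =
    trans (sat-∧ (neg A) (neg B) ρ) (trans (cong₂ _∧_ (sat-neg A a ρ) (sat-neg B b ρ))
      (trans (sym (not-∨ (sat A ρ) (sat B ρ))) (cong not (sym (sat-∨ A B ρ)))))
  sat-neg (fall x A) a ρ =
    quantifier-duality (sat-∀ x A ρ) (sat-∃ x (neg A) ρ) λ v → sat-neg A a (upd ρ x v)
  sat-neg (fex x A)  a ρ = ≡-not-sym
    (quantifier-duality (sat-∀ x (neg A) ρ) (sat-∃ x A ρ) λ v → ≡-not-sym (sat-neg A a (upd ρ x v)))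

  imp-intro : ∀ A {B ρ} → Elem A → (sat A ρ ≡ true → sat B ρ ≡ true) → sat (imp A B) ρ ≡ true
  imp-intro A {B} {ρ} a A⇒B with sat A ρ in A-at-ρ
  ... | true  = ∨-holds .from (inj₂ (A⇒B refl))
  ... | false = ∨-holds .from (inj₁ (trans (sat-neg A a ρ) (cong not A-at-ρ)))

  neg-refutes : ∀ A {ρ} → Elem A → sat (neg A) ρ ≡ true → sat A ρ ≡ true → ⊥
  neg-refutes A {ρ} a ¬A-holds A-holds =
    contradiction (trans (sym ¬A-holds) (trans (sat-neg A a ρ) (cong not A-holds))) λ ()

axioms : ∀ {F} → PA⊢ F → List Formula
axioms (h-pa {A} _)    = A ∷ []
axioms h-top           = []
axioms (h-prop _)      = []
axioms (h-subst _ _)   = []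
axioms h-refl          = []
axioms h-eq-sc         = []
axioms h-eq-⊕          = []
axioms h-eq-⊗          = []
axioms h-eq-≐          = []
axioms (h-expand _ d)  = axioms d
axioms (h-contr d)     = axioms d
axioms (h-assoc d)     = axioms d
axioms (h-cut d₁ d₂)   = axioms d₁ ++ axioms d₂
axioms (h-∃intro _ d)  = axioms d

axioms-PAAxiom : ∀ {F} (d : PA⊢ F) → All PAAxiom (axioms d)
axioms-PAAxiom (h-pa ax)       = ax ∷ []
axioms-PAAxiom h-top           = []
axioms-PAAxiom (h-prop _)      = []
axioms-PAAxiom (h-subst _ _)   = []
axioms-PAAxiom h-refl          = []
axioms-PAAxiom h-eq-sc         = []
axioms-PAAxiom h-eq-⊕          = []
axioms-PAAxiom h-eq-⊗          = []
axioms-PAAxiom h-eq-≐          = []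
axioms-PAAxiom (h-expand _ d)  = axioms-PAAxiom d
axioms-PAAxiom (h-contr d)     = axioms-PAAxiom d
axioms-PAAxiom (h-assoc d)     = axioms-PAAxiom d
axioms-PAAxiom (h-cut d₁ d₂)   = ++⁺ (axioms-PAAxiom d₁) (axioms-PAAxiom d₂)
axioms-PAAxiom (h-∃intro _ d)  = axioms-PAAxiom d

module _ (M : Model) where
  open Model M

  sound : ∀ {F} (d : PA⊢ F) → All (Valid M) (axioms d) → Valid M F
  sound (h-pa _) (A-valid ∷ []) = A-valid
  sound h-top _ = sat-⊤
  sound (h-prop {A} a) _ ρ = imp-intro M A a id
  sound (h-subst {A} {x} {t} a fa) _ ρ = imp-intro M (subst x t A) (Elem-subst A x t a) λ h →
    sat-∃ x A ρ .from (ev str ρ t , trans (sym (sat-subst M A x t a fa ρ)) h)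
  sound h-refl _ ρ = sat-≐ _ _ ρ .from refl
  sound (h-eq-sc {x} {y}) _ ρ = imp-intro M (var x ≐ var y) tt λ x≡y →
    sat-≐ _ _ ρ .from (cong sD (sat-≐ _ _ ρ .to x≡y))
  sound (h-eq-⊕ {x₁} {y₁} {x₂} {y₂}) _ ρ =
    imp-intro M (var x₁ ≐ var y₁) tt λ x₁≡y₁ → imp-intro M (var x₂ ≐ var y₂) tt λ x₂≡y₂ →
    sat-≐ _ _ ρ .from (cong₂ plD (sat-≐ _ _ ρ .to x₁≡y₁) (sat-≐ _ _ ρ .to x₂≡y₂))
  sound (h-eq-⊗ {x₁} {y₁} {x₂} {y₂}) _ ρ =
    imp-intro M (var x₁ ≐ var y₁) tt λ x₁≡y₁ → imp-intro M (var x₂ ≐ var y₂) tt λ x₂≡y₂ →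
    sat-≐ _ _ ρ .from (cong₂ tmD (sat-≐ _ _ ρ .to x₁≡y₁) (sat-≐ _ _ ρ .to x₂≡y₂))
  sound (h-eq-≐ {x₁} {y₁} {x₂} {y₂}) _ ρ =
    imp-intro M (var x₁ ≐ var y₁) tt λ x₁≡y₁ → imp-intro M (var x₂ ≐ var y₂) tt λ x₂≡y₂ →
    imp-intro M (var x₁ ≐ var x₂) tt λ x₁≡x₂ →
    sat-≐ _ _ ρ .from (trans (sym (sat-≐ _ _ ρ .to x₁≡y₁))
                        (trans (sat-≐ _ _ ρ .to x₁≡x₂) (sat-≐ _ _ ρ .to x₂≡y₂)))
  sound (h-expand _ d) valid ρ = ∨-holds M .from (inj₂ (sound d valid ρ))
  sound (h-contr d) valid ρ = [ id , id ] (∨-holds M .to (sound d valid ρ))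
  sound (h-assoc d) valid ρ with ∨-holds M .to (sound d valid ρ)
  ... | inj₁ A-holds = ∨-holds M .from (inj₁ (∨-holds M .from (inj₁ A-holds)))
  ... | inj₂ B∨C-holds with ∨-holds M .to B∨C-holds
  ...   | inj₁ B-holds = ∨-holds M .from (inj₁ (∨-holds M .from (inj₂ B-holds)))
  ...   | inj₂ C-holds = ∨-holds M .from (inj₂ C-holds)
  sound (h-cut {A} d₁ d₂) valid ρ
    with ∨-holds M .to (sound d₁ (++⁻ˡ (axioms d₁) valid) ρ)
       | ∨-holds M .to (sound d₂ (++⁻ʳ (axioms d₁) valid) ρ)
  ... | inj₂ B-holds | _            = ∨-holds M .from (inj₁ B-holds)
  ... | inj₁ _       | inj₂ C-holds = ∨-holds M .from (inj₂ C-holds)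
  ... | inj₁ A-holds | inj₁ ¬A-holds =
    ⊥-elim (neg-refutes M A (proj₁ (PA⊢-Elem d₁)) ¬A-holds A-holds)
  sound (h-∃intro {A} {B} {x} x∉B d) valid ρ with sat B ρ in B-at-ρ
  ... | true  = ∨-holds M .from (inj₂ B-at-ρ)
  ... | false = ∨-holds M .from (inj₁ (sat-∀ x (neg A) ρ .from ¬A-everywhere))
    where
    ¬A-everywhere : ∀ v → sat (neg A) (upd ρ x v) ≡ true
    ¬A-everywhere v with ∨-holds M .to (sound d valid (upd ρ x v))
    ... | inj₁ ¬A-holds = ¬A-holds
    ... | inj₂ B-holds  = contradiction
      (trans (sym B-at-ρ) (trans (sym (sat-upd-fresh M B (proj₂ (PA⊢-Elem d)) x∉B)) B-holds)) λ ()

  conj-holds : ∀ Gs {ρ} → sat (conj Gs) ρ ≡ true → All (λ G → sat G ρ ≡ true) Gs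
  conj-holds []       _ = []
  conj-holds (G ∷ Gs) h = let G-holds , Gs-hold = ∧-holds M .to h in G-holds ∷ conj-holds Gs Gs-hold

  PAAxiom-valid : ∀ {A ρ} → PAAxiom A → sat A ρ ≡ true → Valid M A
  PAAxiom-valid {A} ax A-holds σ =
    trans (coincidence M A (PAAxiom-Elem ax) λ {y} y∈ → ⊥-elim (PAAxiom-closed ax y y∈)) A-holds

PA⊢-valid : ∀ {F} (d : PA⊢ F) → ClassicallyValid (imp (conj (axioms d)) F)
PA⊢-valid d M ρ = imp-intro M (conj (axioms d)) (Elem-conj (All.map PAAxiom-Elem axs)) λ h →
  sound M d (All.zipWith (λ (ax , holds) → PAAxiom-valid M ax holds) (axs , conj-holds M (axioms d) h)) ρ
  where
  axs : All PAAxiom (axioms d)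
  axs = axioms-PAAxiom d

-- Without choice operators Wait has no premises besides classical validity,
-- and ‖·‖ is the identity.
CL12-elementary : ∀ {Gs F} → All Elem Gs → Elem F →
                  ClassicallyValid (imp (conj Gs) F) → CL12 Gs F
CL12-elementary {Gs} {F} Gs-elem F-elem valid = wait valid′
  (λ C _ _ F≡ → ⊥-elim (Elem-plug C (transport Elem F≡ F-elem)))
  (λ C _ _ F≡ → ⊥-elim (Elem-plug C (transport Elem F≡ F-elem)))
  (λ pre _ C _ _ Gs≡ → ⊥-elim (Elem-plug C (in-antecedent pre Gs≡)))
  (λ pre _ C _ _ Gs≡ → ⊥-elim (Elem-plug C (in-antecedent pre Gs≡)))
  where
  valid′ : ClassicallyValid (imp (conj (map elz Gs)) (elz F))
  valid′ rewrite map-id-local (All.map (λ {G} → elz-Elem G) Gs-elem) | elz-Elem F F-elem = valid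
  in-antecedent : ∀ pre {G post} → Gs ≡ pre ++ G ∷ post → Elem G
  in-antecedent pre Gs≡ = All.head (++⁻ʳ pre (transport (All Elem) Gs≡ Gs-elem))

last-∷ʳ : ∀ {A : Set} (xs : List A) x → last (xs ∷ʳ x) ≡ just x
last-∷ʳ []           x = refl
last-∷ʳ (_ ∷ [])     x = refl
last-∷ʳ (_ ∷ y ∷ xs) x = last-∷ʳ (y ∷ xs) x

-- Gs are premises already available, Hs the axioms still to be written down.
axioms-then-LC : ∀ {av prior F} Gs {Hs} → All CLA1Axiom Hs → All WF Hs →
                 All (λ G → fitem G ∈ av) Gs → WF F → CL12 (Gs ++ Hs) F →
                 Deduces av prior (map fstep Hs ∷ʳ fstep F)
axioms-then-LC {F = F} Gs [] [] Gs∈ F-wf ⊢F =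
  d-form F-wf (j-LC Gs Gs∈ (transport (λ Γ → CL12 Γ F) (++-identityʳ Gs) ⊢F)) d-nil
axioms-then-LC {F = F} Gs {H ∷ Hs} (ax ∷ axs) (H-wf ∷ Hs-wf) Gs∈ F-wf ⊢F =
  d-form H-wf (j-axiom ax)
    (axioms-then-LC (Gs ∷ʳ H) axs Hs-wf (++⁺ (All.map there Gs∈) (here refl ∷ [])) F-wf
      (transport (λ Γ → CL12 Γ F) (sym (++-assoc Gs (H ∷ []) Hs)) ⊢F))

CLA1⊢-from-axioms : ∀ {Gs F} → All CLA1Axiom Gs → All WF Gs → WF F → CL12 Gs F → CLA1⊢ F
CLA1⊢-from-axioms {Gs} {F} axs Gs-wf F-wf ⊢F =
  map fstep Gs ∷ʳ fstep F , axioms-then-LC [] axs Gs-wf [] F-wf ⊢F , last-∷ʳ (map fstep Gs) (fstep F)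

fact10p3 : (F : Defs.Formula) → WF F → PA⊢ F → CLA1⊢ F
fact10p3 F F-wf d =
  CLA1⊢-from-axioms (All.map ax-pa axs) (All.map PAAxiom-WF axs) F-wf
    (CL12-elementary (All.map PAAxiom-Elem axs) (PA⊢-Elem d) (PA⊢-valid d))
  where
  axs : All PAAxiom (axioms d)
  axs = axioms-PAAxiom d
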